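{- Let $p\ge1$ and $n\ge 3p+1$, and let $\sigma\in\Delta_2^t(C_n^p)$. With the sets $\mathcal{C}_j$ defined below (vertex order $x_j=j$): (i) If $\{0,m_\sigma-p\}$ is the only disconnected $2$-set in $\sigma^c$, then $m_\sigma\in\{n-p,n-p+1,\dots,n-1\}$. (ii) $\sigma\in\mathcal{C}_{n-p}$ if and only if $\{0,m_\sigma-p\}$ is the only disconnected $2$-set in $\sigma^c$.
   Context: For a graph $G$, $\Delta_2^t(G)$ is the simplicial complex whose faces are the $\sigma\subseteq V(G)$ such that $\sigma^c:=V(G)\setminus\sigma$ contains two distinct non-adjacent vertices. A disconnected $2$-set in $A\subseteq V(G)$ is a pair $\{a,b\}\subseteq A$ of distinct non-adjacent vertices. $C_n^p$ has vertex set $\{0,\dots,n-1\}$ with distinct $u,v$ adjacent iff $v\equiv u\pm t\pmod n$ for some $1\le t\le p$. For $\sigma\in\Delta_2^t(C_n^p)$, $m_\sigma:=\max(\sigma^c)$. Given vertices $x_0,\dots,x_{n-1}$, set $\mathcal{C}_0=\Delta_2^t(G)$ and for $0\le j\le n-1$ put $\mathcal{M}_{x_j}=\{\{\sigma\setminus\{x_j\},\sigma\cup\{x_j\}\}\mid \sigma\setminus\{x_j\},\sigma\cup\{x_j\}\in\mathcal{C}_j\}$ and $\mathcal{C}_{j+1}=\{\sigma\in\mathcal{C}_j\mid \sigma\text{ lies in no pair of }\mathcal{M}_{x_j}\}$. Here $G=C_n^p$ and $x_j=j$. -}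

module Defs where

open import Data.Nat using (ℕ; zero; suc; _+_; _≤_; _<_; _⊔_; NonZero; >-nonZero⁻¹)
open import Data.Nat.DivMod using (_%_)
open import Data.Fin using (Fin; toℕ; fromℕ<)
open import Data.Fin.Subset using (Subset; _∈_; ∁; inside; outside)
open import Data.Vec using (lookup; _[_]≔_)
open import Data.List using (foldr; map; allFin)
open import Data.Bool using (if_then_else_)
open import Data.Product using (Σ; ∃; _×_)
open import Data.Sum using (_⊎_)
open import Relation.Binary.PropositionalEquality using (_≡_; _≢_)
open import Relation.Nullary using (¬_)

module _ (n p : ℕ) .{{_ : NonZero n}} where

  v0 : Fin n
  v0 = fromℕ< (>-nonZero⁻¹ n)

  Adj : Fin n → Fin n → Set
  Adj u v = u ≢ v × ∃ λ t → 1 ≤ t × t ≤ p ×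
            ((toℕ u + t) % n ≡ toℕ v ⊎ (toℕ v + t) % n ≡ toℕ u)

  Disc2 : Subset n → Fin n → Fin n → Set
  Disc2 A a b = a ∈ A × b ∈ A × a ≢ b × ¬ Adj a b

  Face : Subset n → Set
  Face σ = ∃ λ a → ∃ λ b → Disc2 (∁ σ) a b

  -- m_σ = max(σᶜ) (as a natural number; 0 if σᶜ is empty, which never
  -- happens for faces)
  mσ : Subset n → ℕ
  mσ σ = foldr _⊔_ 0 (map (λ i → if lookup σ i then 0 else toℕ i) (allFin n))

  -- The sets C_j for the vertex order x_j = j.
  -- For j ≥ n there is no vertex x_j and nothing is removed (never used).
  mutual
    C : ℕ → Subset n → Set
    C zero σ = Face σ
    C (suc j) σ = C j σ × ¬ InPair j σ

    InPair : ℕ → Subset n → Set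
    InPair j σ = Σ (j < n) λ lt →
      C j (σ [ fromℕ< lt ]≔ outside) × C j (σ [ fromℕ< lt ]≔ inside)

  OnlyDisc : Subset n → Set
  OnlyDisc σ = Σ (Fin n) λ w → toℕ w + p ≡ mσ σ × Disc2 (∁ σ) v0 w ×
    (∀ a b → Disc2 (∁ σ) a b → (a ≡ v0 × b ≡ w) ⊎ (a ≡ w × b ≡ v0))

-- For 1 ≤ j ≤ n − p, C_j consists exactly of the σ that are either Pending at j (0 ∈ σᶜ,
-- every disconnected 2-set of σᶜ contains 0, the other vertices of σᶜ are ≥ j and one is
-- ≥ j + p) or Critical for some a < j (σᶜ = {0, a} ∪ T with p < a, a + p < n and
-- a + p ∈ T ⊆ [n − p, a + p], so that {0, a} is the only disconnected 2-set). Matching along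
-- vertex j keeps every Critical σ, keeps a Pending σ with j ∉ σᶜ whose σᶜ reaches j + p + 1,
-- turns a Pending σ with j ∈ σᶜ into a Critical one for a = j when no other vertex of σᶜ is
-- non-adjacent to 0, and pairs off all remaining Pending σ. At j = n − p nothing is Pending,
-- and Critical a says exactly that {0, m_σ − p} is the only disconnected 2-set, where
-- m_σ = a + p lies in T ⊆ [n − p, n).

module Submission where

open import Defs
open import Data.Nat using (ℕ; zero; suc; _+_; _*_; _∸_; _≤_; _<_; _≮_; _⊔_; NonZero; z≤n; s≤s; s≤s⁻¹; _≤?_; _<?_)
open import Data.Nat.Properties hiding (_≟_)
open import Data.Nat.DivMod using (_%_; m<n⇒m%n≡m; m≤n⇒[n∸m]%m≡n%m; [m+n]%n≡m%n)
open import Data.Nat.Tactic.RingSolver using (solve-∀)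
open import Data.Fin using (Fin; toℕ; fromℕ<; _≟_)
open import Data.Fin.Properties using (toℕ<n; toℕ-injective; toℕ-fromℕ<; any?)
open import Data.Fin.Subset using (Subset; _∈_; _∉_; _⊆_; ∁; inside; outside)
open import Data.Fin.Subset.Properties using (x∈∁p⇒x∉p; x∉p⇒x∈∁p; _∈?_)
open import Data.Vec using (lookup; _[_]≔_)
open import Data.Vec.Properties using ([]=⇒lookup; lookup⇒[]=; lookup∘updateAt; lookup∘updateAt′)
open import Data.Bool using (if_then_else_)
open import Data.Product using (∃; _×_; _,_; proj₁; proj₂; uncurry)
open import Data.Sum using (_⊎_; inj₁; inj₂; [_,_])
import Data.Sum as Sum
open import Data.List using (map; allFin)
open import Data.List.Properties using (foldr-preservesᵒ; foldr-preservesᵇ)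
open import Data.List.Membership.Propositional using (lose) renaming (_∈_ to _∈ˡ_)
open import Data.List.Membership.Propositional.Properties using (∈-map⁺; ∈-map⁻; ∈-allFin; foldr-selective)
import Data.List.Relation.Unary.All as All
open import Data.Empty using (⊥)
open import Function using (_∘_)
open import Function.Bundles using (_⇔_; mk⇔; Equivalence)
open import Relation.Binary.Definitions using (tri<; tri≈; tri>)
open import Relation.Binary.PropositionalEquality hiding ([_])
open import Relation.Nullary using (¬_; Dec; yes; no; contradiction)
open import Relation.Nullary.Decidable using (_×-dec_; ¬?)

module _ {n : ℕ} where

  ∈∁⇒lookup≡outside : ∀ {σ : Subset n} {x} → x ∈ ∁ σ → lookup σ x ≡ outside
  ∈∁⇒lookup≡outside {σ} {x} x∈∁σ with lookup σ x in eq
  ... | outside = refl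
  ... | inside  = contradiction (lookup⇒[]= x σ eq) (x∈∁p⇒x∉p x∈∁σ)

  lookup≡outside⇒∈∁ : ∀ {σ : Subset n} {x} → lookup σ x ≡ outside → x ∈ ∁ σ
  lookup≡outside⇒∈∁ eq = x∉p⇒x∈∁p λ x∈σ → inside≢outside (trans (sym ([]=⇒lookup x∈σ)) eq)
    where
    inside≢outside : inside ≢ outside
    inside≢outside ()

  module _ {σ : Subset n} {k : Fin n} where

    k∈∁[k]≔outside : k ∈ ∁ (σ [ k ]≔ outside)
    k∈∁[k]≔outside = lookup≡outside⇒∈∁ (lookup∘updateAt k σ)

    ∁⊆∁[]≔outside : ∁ σ ⊆ ∁ (σ [ k ]≔ outside)
    ∁⊆∁[]≔outside {x} x∈∁σ with x ≟ k
    ... | yes refl = k∈∁[k]≔outside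
    ... | no x≢k   = lookup≡outside⇒∈∁ (trans (lookup∘updateAt′ x k x≢k σ) (∈∁⇒lookup≡outside x∈∁σ))

    ∈∁[]≔outside⁻ : ∀ {x} → x ∈ ∁ (σ [ k ]≔ outside) → x ≡ k ⊎ x ∈ ∁ σ
    ∈∁[]≔outside⁻ {x} x∈ with x ≟ k
    ... | yes x≡k = inj₁ x≡k
    ... | no x≢k  = inj₂ (lookup≡outside⇒∈∁ (trans (sym (lookup∘updateAt′ x k x≢k σ)) (∈∁⇒lookup≡outside x∈)))

    ∁[]≔outside⊆∁ : k ∈ ∁ σ → ∁ (σ [ k ]≔ outside) ⊆ ∁ σ
    ∁[]≔outside⊆∁ k∈∁σ x∈ with ∈∁[]≔outside⁻ x∈
    ... | inj₁ refl = k∈∁σ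
    ... | inj₂ x∈∁σ = x∈∁σ

    k∉∁[k]≔inside : k ∉ ∁ (σ [ k ]≔ inside)
    k∉∁[k]≔inside k∈ with trans (sym (lookup∘updateAt k σ)) (∈∁⇒lookup≡outside k∈)
    ... | ()

    ∈∁⇒∈∁[]≔inside : ∀ {x} → x ∈ ∁ σ → x ≢ k → x ∈ ∁ (σ [ k ]≔ inside)
    ∈∁⇒∈∁[]≔inside {x} x∈∁σ x≢k = lookup≡outside⇒∈∁ (trans (lookup∘updateAt′ x k x≢k σ) (∈∁⇒lookup≡outside x∈∁σ))

    ∁[]≔inside⊆∁ : ∁ (σ [ k ]≔ inside) ⊆ ∁ σ
    ∁[]≔inside⊆∁ {x} x∈ with x ≟ k
    ... | yes refl = contradiction x∈ k∉∁[k]≔inside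
    ... | no x≢k   = lookup≡outside⇒∈∁ (trans (sym (lookup∘updateAt′ x k x≢k σ)) (∈∁⇒lookup≡outside x∈))

    ∁⊆∁[]≔inside : k ∉ ∁ σ → ∁ σ ⊆ ∁ (σ [ k ]≔ inside)
    ∁⊆∁[]≔inside k∉∁σ {x} x∈∁σ = ∈∁⇒∈∁[]≔inside x∈∁σ λ { refl → k∉∁σ x∈∁σ }

%-below-double : ∀ {m} n .{{_ : NonZero n}} → m < n + n → m % n ≡ m ⊎ m % n + n ≡ m
%-below-double {m} n m<2n with m <? n
... | yes m<n = inj₁ (m<n⇒m%n≡m m<n)
... | no m≮n  = inj₂ (begin
    m % n + n        ≡⟨ cong (_+ n) (sym (m≤n⇒[n∸m]%m≡n%m n≤m)) ⟩
    (m ∸ n) % n + n  ≡⟨ cong (_+ n) (m<n⇒m%n≡m m∸n<n) ⟩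
    m ∸ n + n        ≡⟨ m∸n+n≡m n≤m ⟩
    m                ∎)
  where
  open ≡-Reasoning
  n≤m : n ≤ m
  n≤m = ≮⇒≥ m≮n
  m∸n<n : m ∸ n < n
  m∸n<n = +-cancelʳ-< _ _ n (subst (_< n + n) (sym (m∸n+n≡m n≤m)) m<2n)

module Cycle (n p : ℕ) .{{_ : NonZero n}} (p<n : p < n) where

  v₀ : Fin n
  v₀ = v0 n p

  _~_ : Fin n → Fin n → Set
  _~_ = Adj n p

  Disc : Subset n → Fin n → Fin n → Set
  Disc σ = Disc2 n p (∁ σ)

  toℕ-v₀ : toℕ v₀ ≡ 0
  toℕ-v₀ = toℕ-fromℕ< _

  0<toℕ⇒≢v₀ : ∀ {x} → 0 < toℕ x → x ≢ v₀
  0<toℕ⇒≢v₀ 0<x refl = <⇒≢ 0<x (sym toℕ-v₀)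

  ≢v₀⇒0<toℕ : ∀ {x} → x ≢ v₀ → 0 < toℕ x
  ≢v₀⇒0<toℕ {x} x≢v₀ = n≢0⇒n>0 λ x≡0 → x≢v₀ (toℕ-injective (trans x≡0 (sym toℕ-v₀)))

  toℕ-≢ : ∀ {u v : Fin n} → toℕ u < toℕ v → u ≢ v
  toℕ-≢ u<v refl = <-irrefl refl u<v

  ~-sym : ∀ {u v} → u ~ v → v ~ u
  ~-sym (u≢v , t , 1≤t , t≤p , inj₁ e) = (λ e′ → u≢v (sym e′)) , t , 1≤t , t≤p , inj₂ e
  ~-sym (u≢v , t , 1≤t , t≤p , inj₂ e) = (λ e′ → u≢v (sym e′)) , t , 1≤t , t≤p , inj₁ e

  step-near : ∀ {u t v} → u < n → t ≤ p → (u + t) % n ≡ v → (v ≤ u + p × u ≤ v + p) ⊎ v + n ≤ u + p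
  step-near {u} {t} {v} u<n t≤p refl with %-below-double n (+-mono-< u<n (≤-<-trans t≤p p<n))
  ... | inj₁ e = inj₁ (subst (_≤ u + p) (sym e) (+-monoʳ-≤ u t≤p) , ≤-trans (m≤m+n u t) (subst (_≤ (u + t) % n + p) e (m≤m+n _ p)))
  ... | inj₂ e = inj₂ (subst (_≤ u + p) (sym e) (+-monoʳ-≤ u t≤p))

  far⇒≁ : ∀ {u v} → toℕ u + p < toℕ v → toℕ v + p < toℕ u + n → ¬ u ~ v
  far⇒≁ {u} {v} u+p<v v+p<u+n (_ , _ , _ , t≤p , inj₁ e) with step-near (toℕ<n u) t≤p e
  ... | inj₁ (v≤u+p , _) = <⇒≱ u+p<v v≤u+p
  ... | inj₂ v+n≤u+p     = <⇒≱ (<-≤-trans u+p<v (m≤m+n (toℕ v) n)) v+n≤u+p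
  far⇒≁ {u} {v} u+p<v v+p<u+n (_ , _ , _ , t≤p , inj₂ e) with step-near (toℕ<n v) t≤p e
  ... | inj₁ (_ , v≤u+p) = <⇒≱ u+p<v v≤u+p
  ... | inj₂ u+n≤v+p     = <⇒≱ v+p<u+n u+n≤v+p

  close⇒~ : ∀ {u v} → toℕ u < toℕ v → toℕ v ≤ toℕ u + p → u ~ v
  close⇒~ {u} {v} u<v v≤u+p = toℕ-≢ u<v , toℕ v ∸ toℕ u , m<n⇒0<n∸m u<v , m≤n+o⇒m∸n≤o (toℕ v) (toℕ u) v≤u+p ,
    inj₁ (trans (cong (_% n) (m+[n∸m]≡n (<⇒≤ u<v))) (m<n⇒m%n≡m (toℕ<n v)))

  wrap⇒~ : ∀ {u v} → toℕ u + n ≤ toℕ v + p → u ~ v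
  wrap⇒~ {u} {v} u+n≤v+p = u≢v , toℕ u + n ∸ toℕ v , m<n⇒0<n∸m v<u+n , m≤n+o⇒m∸n≤o (toℕ u + n) (toℕ v) u+n≤v+p ,
      inj₂ (trans (cong (_% n) (m+[n∸m]≡n (<⇒≤ v<u+n))) (trans ([m+n]%n≡m%n (toℕ u) n) (m<n⇒m%n≡m (toℕ<n u))))
    where
    v<u+n : toℕ v < toℕ u + n
    v<u+n = <-≤-trans (toℕ<n v) (m≤n+m n (toℕ u))
    u≢v : u ≢ v
    u≢v refl = <⇒≱ p<n (+-cancelˡ-≤ (toℕ u) n p u+n≤v+p)

  wrap⇒v₀~ : ∀ {s} → n ≤ toℕ s + p → v₀ ~ s
  wrap⇒v₀~ {s} n≤s+p = wrap⇒~ (subst (λ z → z + n ≤ toℕ s + p) (sym toℕ-v₀) n≤s+p)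

  Far₀ : Fin n → Set
  Far₀ z = p < toℕ z × toℕ z + p < n

  Far₀? : ∀ z → Dec (Far₀ z)
  Far₀? z = p <? toℕ z ×-dec toℕ z + p <? n

  Far₀⇒≢v₀ : ∀ {z} → Far₀ z → z ≢ v₀
  Far₀⇒≢v₀ (p<z , _) = 0<toℕ⇒≢v₀ (≤-<-trans z≤n p<z)

  Far₀⇒≁v₀ : ∀ {z} → Far₀ z → ¬ v₀ ~ z
  Far₀⇒≁v₀ {z} (p<z , z+p<n) = far⇒≁ (subst (λ k → k + p < toℕ z) (sym toℕ-v₀) p<z) (subst (λ k → toℕ z + p < k + n) (sym toℕ-v₀) z+p<n)

  ≁v₀⇒Far₀ : ∀ {z} → ¬ v₀ ~ z → z ≢ v₀ → Far₀ z
  ≁v₀⇒Far₀ {z} v₀≁z z≢v₀ with toℕ z ≤? p | toℕ z + p <? n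
  ... | yes z≤p | _ = contradiction (close⇒~ (subst (_< toℕ z) (sym toℕ-v₀) (≢v₀⇒0<toℕ z≢v₀)) (subst (λ k → toℕ z ≤ k + p) (sym toℕ-v₀) z≤p)) v₀≁z
  ... | no z≰p | yes z+p<n = ≰⇒> z≰p , z+p<n
  ... | no _   | no z+p≮n  = contradiction (wrap⇒v₀~ (≮⇒≥ z+p≮n)) v₀≁z

  far⇒Disc : ∀ {σ u v} → u ∈ ∁ σ → v ∈ ∁ σ → toℕ u + p < toℕ v → toℕ v + p < toℕ u + n → Disc σ u v
  far⇒Disc {u = u} u∈ v∈ u+p<v v+p<u+n = u∈ , v∈ , toℕ-≢ (≤-<-trans (m≤m+n (toℕ u) p) u+p<v) , far⇒≁ u+p<v v+p<u+n

  Disc-sym : ∀ {σ a b} → Disc σ a b → Disc σ b a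
  Disc-sym (a∈ , b∈ , a≢b , a≁b) = b∈ , a∈ , ≢-sym a≢b , a≁b ∘ ~-sym

  Disc-mono : ∀ {σ τ a b} → ∁ σ ⊆ ∁ τ → Disc σ a b → Disc τ a b
  Disc-mono ⊆ (a∈ , b∈ , a≢b , a≁b) = ⊆ a∈ , ⊆ b∈ , a≢b , a≁b

  Face-mono : ∀ {σ τ} → ∁ σ ⊆ ∁ τ → Face n p σ → Face n p τ
  Face-mono ⊆ (a , b , d) = a , b , Disc-mono ⊆ d

module _ (n p : ℕ) .{{_ : NonZero n}} {σ : Subset n} where

  private
    entry : Fin n → ℕ
    entry i = if lookup σ i then 0 else toℕ i

  ≤mσ : ∀ {x} → x ∈ ∁ σ → toℕ x ≤ mσ n p σ
  ≤mσ {x} x∈∁σ = foldr-preservesᵒ {P = toℕ x ≤_} {f = _⊔_} (λ a b → [ m≤n⇒m≤n⊔o b , m≤n⇒m≤o⊔n a ]) 0 (map entry (allFin n))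
    (inj₂ (lose (∈-map⁺ entry (∈-allFin x)) (≤-reflexive (sym entry-x))))
    where
    entry-x : entry x ≡ toℕ x
    entry-x rewrite ∈∁⇒lookup≡outside x∈∁σ = refl

  mσ≤ : ∀ {b} → (∀ {x} → x ∈ ∁ σ → toℕ x ≤ b) → mσ n p σ ≤ b
  mσ≤ {b} bound = foldr-preservesᵇ ⊔-lub z≤n (All.tabulate λ y∈ → entry≤ y∈)
    where
    entry≤ : ∀ {y} → y ∈ˡ map entry (allFin n) → y ≤ b
    entry≤ y∈ with ∈-map⁻ entry y∈
    ... | i , _ , refl with lookup σ i in eq
    ...   | inside  = z≤n
    ...   | outside = bound (lookup≡outside⇒∈∁ eq)

  mσ-attained : 0 < mσ n p σ → ∃ λ x → x ∈ ∁ σ × toℕ x ≡ mσ n p σ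
  mσ-attained 0<m with foldr-selective ⊔-sel 0 (map entry (allFin n))
  ... | inj₁ m≡0 = contradiction m≡0 (≢-sym (<⇒≢ 0<m))
  ... | inj₂ m∈ with ∈-map⁻ entry m∈
  ...   | i , _ , m≡ with lookup σ i in eq
  ...     | inside  = contradiction m≡ (≢-sym (<⇒≢ 0<m))
  ...     | outside = i , lookup≡outside⇒∈∁ eq , sym m≡

module Stages (n p : ℕ) .{{_ : NonZero n}} (1≤p : 1 ≤ p) (3p+1≤n : 3 * p + 1 ≤ n) where

  p<n : p < n
  p<n = <-≤-trans (s≤s (m≤n*m p 3)) (subst (_≤ n) (+-comm (3 * p) 1) 3p+1≤n)

  open Cycle n p p<n

  0<n : 0 < n
  0<n = ≤-<-trans z≤n p<n

  record Rooted (σ : Subset n) : Set where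
    field
      v₀∈∁ : v₀ ∈ ∁ σ
      face : Face n p σ
      through-v₀ : ∀ a b → Disc σ a b → a ≡ v₀ ⊎ b ≡ v₀

  Rooted⇒¬Disc-off-v₀ : ∀ {σ a b} → Rooted σ → a ≢ v₀ → b ≢ v₀ → ¬ Disc σ a b
  Rooted⇒¬Disc-off-v₀ {a = a} {b} r a≢v₀ b≢v₀ disc = Sum.[ a≢v₀ , b≢v₀ ] (Rooted.through-v₀ r a b disc)

  Rooted⇒Far₀ : ∀ {σ} → Rooted σ → ∃ λ z → z ∈ ∁ σ × Far₀ z
  Rooted⇒Far₀ r with Rooted.face r
  ... | a , b , disc@(a∈ , b∈ , a≢b , a≁b) with Rooted.through-v₀ r a b disc
  ...   | inj₁ refl = b , b∈ , ≁v₀⇒Far₀ a≁b (≢-sym a≢b)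
  ...   | inj₂ refl = a , a∈ , ≁v₀⇒Far₀ (a≁b ∘ ~-sym) a≢b

  record Pending (j : ℕ) (σ : Subset n) : Set where
    field
      rooted : Rooted σ
      above : ∀ {x} → x ∈ ∁ σ → x ≢ v₀ → j ≤ toℕ x
      far : ∃ λ x → x ∈ ∁ σ × j + p ≤ toℕ x

  Pending-resp : ∀ {j σ τ} → ∁ σ ⊆ ∁ τ → ∁ τ ⊆ ∁ σ → Pending j σ → Pending j τ
  Pending-resp σ⊆τ τ⊆σ pend = record
    { rooted = record
      { v₀∈∁ = σ⊆τ v₀∈∁
      ; face = Face-mono σ⊆τ face
      ; through-v₀ = λ a b → through-v₀ a b ∘ Disc-mono τ⊆σ
      }
    ; above = above ∘ τ⊆σ
    ; far = let (x , x∈ , j+p≤x) = far in x , σ⊆τ x∈ , j+p≤x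
    }
    where
    open Pending pend
    open Rooted rooted

  Pending-pred : ∀ {j σ} → Pending (suc j) σ → Pending j σ
  Pending-pred pend = record
    { rooted = rooted
    ; above = λ x∈ x≢v₀ → <⇒≤ (above x∈ x≢v₀)
    ; far = let (x , x∈ , 1+j+p≤x) = far in x , x∈ , <⇒≤ 1+j+p≤x
    }
    where open Pending pend

  record Critical (a : Fin n) (σ : Subset n) : Set where
    field
      v₀∈∁ : v₀ ∈ ∁ σ
      a∈∁ : a ∈ ∁ σ
      far₀ : Far₀ a
      top : Fin n
      top∈∁ : top ∈ ∁ σ
      toℕ-top : toℕ top ≡ toℕ a + p
      tail : ∀ {x} → x ∈ ∁ σ → x ≢ v₀ → x ≢ a → n ≤ toℕ x + p × toℕ x ≤ toℕ a + p

  data CriticalVertex (a x : Fin n) : Set where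
    is-v₀ : x ≡ v₀ → CriticalVertex a x
    is-a : x ≡ a → CriticalVertex a x
    in-tail : n ≤ toℕ x + p → toℕ x ≤ toℕ a + p → CriticalVertex a x

  module _ {a σ} (c : Critical a σ) where
    open Critical c

    classify : ∀ {x} → x ∈ ∁ σ → CriticalVertex a x
    classify {x} x∈ with x ≟ v₀ | x ≟ a
    ... | yes x≡v₀ | _       = is-v₀ x≡v₀
    ... | no _     | yes x≡a = is-a x≡a
    ... | no x≢v₀  | no x≢a  = uncurry in-tail (tail x∈ x≢v₀ x≢a)

    private
      a~tail : ∀ {s} → n ≤ toℕ s + p → toℕ s ≤ toℕ a + p → a ~ s
      a~tail n≤s+p s≤a+p = close⇒~ (+-cancelʳ-< p _ _ (<-≤-trans (proj₂ far₀) n≤s+p)) s≤a+p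

      tail~tail : ∀ {s s′} → n ≤ toℕ s + p → toℕ s′ ≤ toℕ a + p → toℕ s < toℕ s′ → s ~ s′
      tail~tail n≤s+p s′≤a+p s<s′ = close⇒~ s<s′ (≤-trans s′≤a+p (≤-trans (<⇒≤ (proj₂ far₀)) n≤s+p))

    Critical-Disc-unique : ∀ b d → Disc σ b d → (b ≡ v₀ × d ≡ a) ⊎ (b ≡ a × d ≡ v₀)
    Critical-Disc-unique b d (b∈ , d∈ , b≢d , b≁d) with classify b∈ | classify d∈
    ... | is-v₀ b≡v₀ | is-a d≡a     = inj₁ (b≡v₀ , d≡a)
    ... | is-a b≡a   | is-v₀ d≡v₀   = inj₂ (b≡a , d≡v₀)
    ... | is-v₀ refl | is-v₀ refl   = contradiction refl b≢d
    ... | is-a refl  | is-a refl    = contradiction refl b≢d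
    ... | is-v₀ refl | in-tail d₁ _ = contradiction (wrap⇒v₀~ d₁) b≁d
    ... | in-tail b₁ _ | is-v₀ refl = contradiction (~-sym (wrap⇒v₀~ b₁)) b≁d
    ... | is-a refl  | in-tail d₁ d₂ = contradiction (a~tail d₁ d₂) b≁d
    ... | in-tail b₁ b₂ | is-a refl  = contradiction (~-sym (a~tail b₁ b₂)) b≁d
    ... | in-tail b₁ b₂ | in-tail d₁ d₂ with <-cmp (toℕ b) (toℕ d)
    ...   | tri< b<d _ _ = contradiction (tail~tail b₁ d₂ b<d) b≁d
    ...   | tri≈ _ b≡d _ = contradiction (toℕ-injective b≡d) b≢d
    ...   | tri> _ _ d<b = contradiction (~-sym (tail~tail d₁ b₂ d<b)) b≁d

    Critical⇒Disc : Disc σ v₀ a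
    Critical⇒Disc = v₀∈∁ , a∈∁ , ≢-sym (Far₀⇒≢v₀ far₀) , Far₀⇒≁v₀ far₀

    Critical⇒Rooted : Rooted σ
    Critical⇒Rooted = record
      { v₀∈∁ = v₀∈∁
      ; face = v₀ , a , Critical⇒Disc
      ; through-v₀ = λ b d → Sum.map proj₁ proj₂ ∘ Critical-Disc-unique b d
      }

    Critical⇒Pending : Pending (toℕ a) σ
    Critical⇒Pending = record
      { rooted = Critical⇒Rooted
      ; above = above
      ; far = top , top∈∁ , ≤-reflexive (sym toℕ-top)
      }
      where
      above : ∀ {x} → x ∈ ∁ σ → x ≢ v₀ → toℕ a ≤ toℕ x
      above x∈ x≢v₀ with classify x∈
      ... | is-v₀ x≡v₀   = contradiction x≡v₀ x≢v₀
      ... | is-a refl    = ≤-refl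
      ... | in-tail n≤x+p _ = <⇒≤ (+-cancelʳ-< p _ _ (<-≤-trans (proj₂ far₀) n≤x+p))

    top-in-tail : n ≤ toℕ top + p
    top-in-tail = proj₁ (tail top∈∁ (0<toℕ⇒≢v₀ (≤-<-trans z≤n a<top)) (≢-sym (toℕ-≢ a<top)))
      where
      a<top : toℕ a < toℕ top
      a<top = subst (toℕ a <_) (sym toℕ-top) (m<m+n (toℕ a) 1≤p)

    mσ≡ : mσ n p σ ≡ toℕ a + p
    mσ≡ = ≤-antisym (mσ≤ n p bound) (subst (_≤ mσ n p σ) toℕ-top (≤mσ n p top∈∁))
      where
      bound : ∀ {x} → x ∈ ∁ σ → toℕ x ≤ toℕ a + p
      bound x∈ with classify x∈
      ... | is-v₀ refl = subst (_≤ toℕ a + p) (sym toℕ-v₀) z≤n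
      ... | is-a refl  = m≤m+n (toℕ a) p
      ... | in-tail _ x≤a+p = x≤a+p

  Survives : ℕ → Subset n → Set
  Survives j σ = Pending j σ ⊎ ∃ λ a → toℕ a < j × Critical a σ

  Survives-pred : ∀ {j σ} → Survives (suc j) σ → Survives j σ
  Survives-pred (inj₁ pend) = inj₁ (Pending-pred pend)
  Survives-pred {j} {σ} (inj₂ (a , a<1+j , c)) with toℕ a <? j
  ... | yes a<j = inj₂ (a , a<j , c)
  ... | no a≮j  = inj₁ (subst (λ i → Pending i σ) (≤-antisym (s≤s⁻¹ a<1+j) (≮⇒≥ a≮j)) (Critical⇒Pending c))

  u+n≤v+p⇒u+p+p<v : ∀ {u v} → u + n ≤ v + p → u + p + p < v
  u+n≤v+p⇒u+p+p<v {u} {v} u+n≤v+p = +-cancelʳ-≤ p _ _ (begin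
    suc (u + p + p) + p  ≡⟨ rearrange u p ⟩
    u + (3 * p + 1)      ≤⟨ +-monoʳ-≤ u 3p+1≤n ⟩
    u + n                ≤⟨ u+n≤v+p ⟩
    v + p                ∎)
    where
    open ≤-Reasoning
    rearrange : ∀ j p → suc (j + p + p) + p ≡ j + (3 * p + 1)
    rearrange = solve-∀

  module Step {j : ℕ} (k : Fin n) (toℕ-k : toℕ k ≡ j) (1≤j : 1 ≤ j) (j+p<n : j + p < n) (σ : Subset n) where

    σ∖k σ∪k : Subset n
    σ∖k = σ [ k ]≔ outside
    σ∪k = σ [ k ]≔ inside

    k≢v₀ : k ≢ v₀
    k≢v₀ = 0<toℕ⇒≢v₀ (subst (0 <_) (sym toℕ-k) 1≤j)

    <j⇒≢k : ∀ {x} → toℕ x < j → x ≢ k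
    <j⇒≢k x<j refl = <-irrefl toℕ-k x<j

    ¬Survives-σ∖k-below : ∀ {a} → Critical a σ → toℕ a < j → ¬ Survives j σ∖k
    ¬Survives-σ∖k-below c a<j (inj₁ pend) =
      <⇒≱ a<j (Pending.above pend (∁⊆∁[]≔outside (Critical.a∈∁ c)) (Far₀⇒≢v₀ (Critical.far₀ c)))
    ¬Survives-σ∖k-below c a<j (inj₂ (a′ , a′<j , c′)) =
      <⇒≱ j+p<n (subst (λ i → n ≤ i + p) toℕ-k (proj₁ (Critical.tail c′ k∈∁[k]≔outside k≢v₀ (≢-sym (<j⇒≢k a′<j)))))

    ¬Survives-σ∪k-at : Critical k σ → ¬ Survives j σ∪k
    ¬Survives-σ∪k-at c (inj₁ pend) with Rooted.face (Pending.rooted pend)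
    ... | b , d , disc with Critical-Disc-unique c b d (Disc-mono ∁[]≔inside⊆∁ disc)
    ...   | inj₁ (_ , refl) = k∉∁[k]≔inside (proj₁ (proj₂ disc))
    ...   | inj₂ (refl , _) = k∉∁[k]≔inside (proj₁ disc)
    ¬Survives-σ∪k-at c (inj₂ (a′ , a′<j , c′)) = <⇒≱ j+p<n (begin
      n            ≤⟨ proj₁ (Critical.tail c (∁[]≔inside⊆∁ (Critical.a∈∁ c′)) (Far₀⇒≢v₀ (Critical.far₀ c′)) (<j⇒≢k a′<j)) ⟩
      toℕ a′ + p   ≤⟨ +-monoˡ-≤ p (<⇒≤ a′<j) ⟩
      j + p        ∎)
      where open ≤-Reasoning

    ¬Survives-σ∖k-pending : Pending (suc j) σ → ¬ Survives j σ∖k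
    ¬Survives-σ∖k-pending pend (inj₂ (a′ , a′<j , c′)) with ∈∁[]≔outside⁻ (Critical.a∈∁ c′)
    ... | inj₁ a′≡k = <j⇒≢k a′<j a′≡k
    ... | inj₂ a′∈  = <⇒≱ a′<j (<⇒≤ (Pending.above pend a′∈ (Far₀⇒≢v₀ (Critical.far₀ c′))))
    -- One of {k, x}, {k, z}, {z, x} is a disconnected 2-set avoiding 0, where x ≥ j + p + 1 and
    -- z is the vertex of σᶜ non-adjacent to 0; the last case uses n ≥ 3p + 1.
    ¬Survives-σ∖k-pending pend (inj₁ pend′) with Rooted⇒Far₀ (Pending.rooted pend) | Pending.far pend
    ... | z , z∈ , p<z , z+p<n | x , x∈ , j+p<x with toℕ x + p <? j + n
    ...   | yes x+p<j+n = Rooted⇒¬Disc-off-v₀ (Pending.rooted pend′) k≢v₀ x≢v₀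
              (far⇒Disc k∈∁[k]≔outside (∁⊆∁[]≔outside x∈) (k+p< j+p<x) (subst (λ i → toℕ x + p < i + n) (sym toℕ-k) x+p<j+n))
      where
      x≢v₀ : x ≢ v₀
      x≢v₀ = 0<toℕ⇒≢v₀ (≤-<-trans z≤n j+p<x)
      k+p< : ∀ {y} → j + p < toℕ y → toℕ k + p < toℕ y
      k+p< = subst (λ i → i + p < _) (sym toℕ-k)
    ...   | no x+p≮j+n with toℕ z ≤? j + p
    ...     | no z≰j+p = Rooted⇒¬Disc-off-v₀ (Pending.rooted pend′) k≢v₀ (Far₀⇒≢v₀ (p<z , z+p<n))
                (far⇒Disc k∈∁[k]≔outside (∁⊆∁[]≔outside z∈) (subst (λ i → i + p < toℕ z) (sym toℕ-k) (≰⇒> z≰j+p))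
                  (<-≤-trans z+p<n (m≤n+m n (toℕ k))))
    ...     | yes z≤j+p = Rooted⇒¬Disc-off-v₀ (Pending.rooted pend) (Far₀⇒≢v₀ (p<z , z+p<n)) (0<toℕ⇒≢v₀ (≤-<-trans z≤n j+p<x))
                (far⇒Disc z∈ x∈ (≤-<-trans (+-monoˡ-≤ p z≤j+p) (u+n≤v+p⇒u+p+p<v (≮⇒≥ x+p≮j+n)))
                  (subst (toℕ x + p <_) (+-comm n (toℕ z)) (+-mono-< (toℕ<n x) p<z)))

    Survives-suc⇒¬pair : Survives (suc j) σ → Survives j σ∖k → Survives j σ∪k → ⊥
    Survives-suc⇒¬pair (inj₁ pend) s∖ _ = ¬Survives-σ∖k-pending pend s∖
    Survives-suc⇒¬pair (inj₂ (a , a<1+j , c)) s∖ s∪ with toℕ a <? j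
    ... | yes a<j = ¬Survives-σ∖k-below c a<j s∖
    ... | no a≮j  = ¬Survives-σ∪k-at (subst (λ b → Critical b σ) a≡k c) s∪
      where
      a≡k : a ≡ k
      a≡k = toℕ-injective (trans (≤-antisym (s≤s⁻¹ a<1+j) (≮⇒≥ a≮j)) (sym toℕ-k))

    module _ (pend : Pending j σ) where
      open Pending pend
      open Rooted rooted

      Pending⇒Pending-σ∖k : (∀ {y} → y ∈ ∁ σ → toℕ y < suc j + p) → Pending j σ∖k
      Pending⇒Pending-σ∖k below = record
        { rooted = record
          { v₀∈∁ = ∁⊆∁[]≔outside v₀∈∁
          ; face = Face-mono ∁⊆∁[]≔outside face
          ; through-v₀ = through
          }
        ; above = above′
        ; far = let (x , x∈ , j+p≤x) = far in x , ∁⊆∁[]≔outside x∈ , j+p≤x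
        }
        where
        k≁⇒≡v₀ : ∀ {c} → c ∈ ∁ σ → k ≢ c → ¬ k ~ c → c ≡ v₀
        k≁⇒≡v₀ {c} c∈ k≢c k≁c with c ≟ v₀
        ... | yes c≡v₀ = c≡v₀
        ... | no c≢v₀  = contradiction (close⇒~ k<c c≤k+p) k≁c
          where
          k<c : toℕ k < toℕ c
          k<c = subst (_< toℕ c) (sym toℕ-k) (≤∧≢⇒< (above c∈ c≢v₀) (λ j≡c → k≢c (toℕ-injective (trans toℕ-k j≡c))))
          c≤k+p : toℕ c ≤ toℕ k + p
          c≤k+p = subst (λ i → toℕ c ≤ i + p) (sym toℕ-k) (s≤s⁻¹ (below c∈))
        through : ∀ a b → Disc σ∖k a b → a ≡ v₀ ⊎ b ≡ v₀
        through a b (a∈ , b∈ , a≢b , a≁b) with ∈∁[]≔outside⁻ a∈ | ∈∁[]≔outside⁻ b∈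
        ... | inj₁ refl | inj₁ refl = contradiction refl a≢b
        ... | inj₁ refl | inj₂ b∈σ  = inj₂ (k≁⇒≡v₀ b∈σ a≢b a≁b)
        ... | inj₂ a∈σ  | inj₁ refl = inj₁ (k≁⇒≡v₀ a∈σ (≢-sym a≢b) (a≁b ∘ ~-sym))
        ... | inj₂ a∈σ  | inj₂ b∈σ  = through-v₀ a b (a∈σ , b∈σ , a≢b , a≁b)
        above′ : ∀ {x} → x ∈ ∁ σ∖k → x ≢ v₀ → j ≤ toℕ x
        above′ x∈ x≢v₀ with ∈∁[]≔outside⁻ x∈
        ... | inj₁ refl = ≤-reflexive (sym toℕ-k)
        ... | inj₂ x∈σ  = above x∈σ x≢v₀

      Pending⇒Pending-suc : k ∉ ∁ σ → ∀ {y} → y ∈ ∁ σ → suc j + p ≤ toℕ y → Pending (suc j) σ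
      Pending⇒Pending-suc k∉ {y} y∈ 1+j+p≤y = record
        { rooted = rooted
        ; above = λ x∈ x≢v₀ → ≤∧≢⇒< (above x∈ x≢v₀) (λ j≡x → k∉ (subst (_∈ ∁ σ) (toℕ-injective (trans (sym j≡x) (sym toℕ-k))) x∈))
        ; far = y , y∈ , 1+j+p≤y
        }

      Pending⇒Pending-σ∪k : ∀ {y} → y ∈ ∁ σ → y ≢ k → Far₀ y → Pending j σ∪k
      Pending⇒Pending-σ∪k {y} y∈ y≢k far₀-y = record
        { rooted = record
          { v₀∈∁ = ∈∁⇒∈∁[]≔inside v₀∈∁ (≢-sym k≢v₀)
          ; face = v₀ , y , ∈∁⇒∈∁[]≔inside v₀∈∁ (≢-sym k≢v₀) , ∈∁⇒∈∁[]≔inside y∈ y≢k , ≢-sym (Far₀⇒≢v₀ far₀-y) , Far₀⇒≁v₀ far₀-y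
          ; through-v₀ = λ a b → through-v₀ a b ∘ Disc-mono ∁[]≔inside⊆∁
          }
        ; above = above ∘ ∁[]≔inside⊆∁
        ; far = let (x , x∈ , j+p≤x) = far in x , ∈∁⇒∈∁[]≔inside x∈ (x≢k j+p≤x) , j+p≤x
        }
        where
        x≢k : ∀ {x} → j + p ≤ toℕ x → x ≢ k
        x≢k j+p≤x refl = <⇒≱ (m<m+n j 1≤p) (subst (j + p ≤_) toℕ-k j+p≤x)

      Pending⇒Critical-k : k ∈ ∁ σ → (∀ {y} → y ∈ ∁ σ → y ≢ k → ¬ Far₀ y) → Critical k σ
      Pending⇒Critical-k k∈ no-other = record
        { v₀∈∁ = v₀∈∁
        ; a∈∁ = k∈
        ; far₀ = far₀-k
        ; top = x
        ; top∈∁ = x∈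
        ; toℕ-top = ≤-antisym (≤k+p x∈) (subst (λ i → i + p ≤ toℕ x) (sym toℕ-k) j+p≤x)
        ; tail = λ w∈ w≢v₀ w≢k → ≮⇒≥ (w+p≮n w∈ w≢v₀ w≢k) , ≤k+p w∈
        }
        where
        x : Fin n
        x = proj₁ far
        x∈ : x ∈ ∁ σ
        x∈ = proj₁ (proj₂ far)
        j+p≤x : j + p ≤ toℕ x
        j+p≤x = proj₂ (proj₂ far)
        far₀-k : Far₀ k
        far₀-k with Rooted⇒Far₀ rooted
        ... | z , z∈ , far₀-z with z ≟ k
        ...   | yes refl = far₀-z
        ...   | no z≢k   = contradiction far₀-z (no-other z∈ z≢k)
        ≤k+p : ∀ {w} → w ∈ ∁ σ → toℕ w ≤ toℕ k + p
        ≤k+p {w} w∈ with toℕ w ≤? toℕ k + p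
        ... | yes w≤k+p = w≤k+p
        ... | no w≰k+p  = contradiction (far⇒Disc k∈ w∈ (≰⇒> w≰k+p) w+p<k+n) (Rooted⇒¬Disc-off-v₀ rooted k≢v₀ w≢v₀)
          where
          w+p<k+n : toℕ w + p < toℕ k + n
          w+p<k+n = subst (toℕ w + p <_) (+-comm n (toℕ k)) (+-mono-< (toℕ<n w) (proj₁ far₀-k))
          w≢v₀ : w ≢ v₀
          w≢v₀ = 0<toℕ⇒≢v₀ (≤-<-trans z≤n (≰⇒> w≰k+p))
        w+p≮n : ∀ {w} → w ∈ ∁ σ → w ≢ v₀ → w ≢ k → toℕ w + p ≮ n
        w+p≮n {w} w∈ w≢v₀ w≢k w+p<n = no-other w∈ w≢k (p<w , w+p<n)
          where
          p<w : p < toℕ w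
          p<w = <-≤-trans (proj₁ far₀-k) (subst (_≤ toℕ w) (sym toℕ-k) (above w∈ w≢v₀))

    Survives⇒Survives-suc⊎pair : Survives j σ → Survives (suc j) σ ⊎ (Survives j σ∖k × Survives j σ∪k)
    Survives⇒Survives-suc⊎pair (inj₂ (a , a<j , c)) = inj₁ (inj₂ (a , m<n⇒m<1+n a<j , c))
    Survives⇒Survives-suc⊎pair (inj₁ pend) with k ∈? ∁ σ
    ... | yes k∈ with any? (λ y → y ∈? ∁ σ ×-dec ¬? (y ≟ k) ×-dec Far₀? y)
    ...   | yes (y , y∈ , y≢k , far₀-y) =
              inj₂ (inj₁ (Pending-resp ∁⊆∁[]≔outside (∁[]≔outside⊆∁ k∈) pend) , inj₁ (Pending⇒Pending-σ∪k pend y∈ y≢k far₀-y))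
    ...   | no ∄y = inj₁ (inj₂ (k , subst (_< suc j) (sym toℕ-k) ≤-refl ,
              Pending⇒Critical-k pend k∈ (λ y∈ y≢k far₀-y → ∄y (_ , y∈ , y≢k , far₀-y))))
    Survives⇒Survives-suc⊎pair (inj₁ pend) | no k∉ with any? (λ y → y ∈? ∁ σ ×-dec suc j + p ≤? toℕ y)
    ...   | yes (y , y∈ , 1+j+p≤y) = inj₁ (inj₁ (Pending⇒Pending-suc pend k∉ y∈ 1+j+p≤y))
    ...   | no ∄y = inj₂ (inj₁ (Pending⇒Pending-σ∖k pend (λ y∈ → ≰⇒> (λ le → ∄y (_ , y∈ , le)))) ,
              inj₁ (Pending-resp (∁⊆∁[]≔inside k∉) ∁[]≔inside⊆∁ pend))

  -- InPair j names vertex j as fromℕ< lt; since fromℕ< ignores its irrelevant proof argument,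
  -- this is definitionally v₀ for j = 0 and fromℕ< 1+j<n in C⇔Survives-suc.
  module _ {σ : Subset n} where

    C₁⇒Pending₁ : C n p 1 σ → Pending 1 σ
    C₁⇒Pending₁ (face , ¬pair) with v₀ ∈? ∁ σ
    ... | no v₀∉ = contradiction (0<n , Face-mono ∁⊆∁[]≔outside face , Face-mono (∁⊆∁[]≔inside v₀∉) face) ¬pair
    ... | yes v₀∈ = record
      { rooted = rooted
      ; above = λ _ → ≢v₀⇒0<toℕ
      ; far = let (z , z∈ , p<z , _) = Rooted⇒Far₀ rooted in z , z∈ , p<z
      }
      where
      through : ∀ a b → Disc σ a b → a ≡ v₀ ⊎ b ≡ v₀
      through a b disc@(a∈ , b∈ , a≢b , a≁b) with a ≟ v₀ | b ≟ v₀
      ... | yes a≡v₀ | _        = inj₁ a≡v₀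
      ... | no _     | yes b≡v₀ = inj₂ b≡v₀
      ... | no a≢v₀  | no b≢v₀  = contradiction
            (0<n , Face-mono ∁⊆∁[]≔outside face , (a , b , ∈∁⇒∈∁[]≔inside a∈ a≢v₀ , ∈∁⇒∈∁[]≔inside b∈ b≢v₀ , a≢b , a≁b))
            ¬pair
      rooted : Rooted σ
      rooted = record { v₀∈∁ = v₀∈ ; face = face ; through-v₀ = through }

    Pending₁⇒C₁ : Pending 1 σ → C n p 1 σ
    Pending₁⇒C₁ pend = Rooted.face (Pending.rooted pend) , λ { (_ , _ , (a , b , disc)) →
      Sum.[ (λ { refl → k∉∁[k]≔inside (proj₁ disc) }) , (λ { refl → k∉∁[k]≔inside (proj₁ (proj₂ disc)) }) ]
        (Rooted.through-v₀ (Pending.rooted pend) a b (Disc-mono ∁[]≔inside⊆∁ disc)) }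

    Survives₁⇒Pending₁ : Survives 1 σ → Pending 1 σ
    Survives₁⇒Pending₁ (inj₁ pend) = pend
    Survives₁⇒Pending₁ (inj₂ (a , a<1 , c)) = contradiction (≤-<-trans z≤n (proj₁ (Critical.far₀ c))) (<⇒≱ a<1)

  C⇔Survives-suc : ∀ {j} → suc j + p < n → (∀ τ → C n p (suc j) τ ⇔ Survives (suc j) τ) →
                   ∀ σ → C n p (suc (suc j)) σ ⇔ Survives (suc (suc j)) σ
  C⇔Survives-suc {j} 1+j+p<n IH σ = mk⇔ to from
    where
    1+j<n : suc j < n
    1+j<n = ≤-<-trans (m≤m+n (suc j) p) 1+j+p<n
    open Step (fromℕ< 1+j<n) (toℕ-fromℕ< 1+j<n) (s≤s z≤n) 1+j+p<n σ
    to : C n p (suc (suc j)) σ → Survives (suc (suc j)) σ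
    to (c , ¬pair) with Survives⇒Survives-suc⊎pair (Equivalence.to (IH σ) c)
    ... | inj₁ s = s
    ... | inj₂ (s∖ , s∪) = contradiction (1+j<n , Equivalence.from (IH σ∖k) s∖ , Equivalence.from (IH σ∪k) s∪) ¬pair
    from : Survives (suc (suc j)) σ → C n p (suc (suc j)) σ
    from s = Equivalence.from (IH σ) (Survives-pred s) ,
      λ (_ , c∖ , c∪) → Survives-suc⇒¬pair s (Equivalence.to (IH σ∖k) c∖) (Equivalence.to (IH σ∪k) c∪)

  C⇔Survives : ∀ j → 1 ≤ j → j + p ≤ n → ∀ σ → C n p j σ ⇔ Survives j σ
  C⇔Survives (suc zero)    _ _        σ = mk⇔ (inj₁ ∘ C₁⇒Pending₁) (Pending₁⇒C₁ ∘ Survives₁⇒Pending₁)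
  C⇔Survives (suc (suc j)) _ 2+j+p≤n =
    C⇔Survives-suc 2+j+p≤n (C⇔Survives (suc j) (s≤s z≤n) (<⇒≤ 2+j+p≤n))

  module _ {σ : Subset n} where

    ¬Pending-n∸p : ¬ Pending (n ∸ p) σ
    ¬Pending-n∸p pend with Pending.far pend
    ... | x , _ , n∸p+p≤x = <⇒≱ (toℕ<n x) (subst (_≤ toℕ x) (m∸n+n≡m (<⇒≤ p<n)) n∸p+p≤x)

    Survives⇒OnlyDisc : Survives (n ∸ p) σ → OnlyDisc n p σ
    Survives⇒OnlyDisc (inj₁ pend)        = contradiction pend ¬Pending-n∸p
    Survives⇒OnlyDisc (inj₂ (a , _ , c)) = a , sym (mσ≡ c) , Critical⇒Disc c , Critical-Disc-unique c

    OnlyDisc⇒Critical : (od : OnlyDisc n p σ) → Critical (proj₁ od) σ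
    OnlyDisc⇒Critical (w , w+p≡m , (v₀∈ , w∈ , v₀≢w , v₀≁w) , unique) = record
      { v₀∈∁ = v₀∈
      ; a∈∁ = w∈
      ; far₀ = far₀-w
      ; top = y
      ; top∈∁ = y∈
      ; toℕ-top = y≡w+p
      ; tail = λ x∈ x≢v₀ x≢w → ≮⇒≥ (x+p≮n x∈ x≢v₀ x≢w) , subst (_ ≤_) (sym w+p≡m) (≤mσ n p x∈)
      }
      where
      far₀-w : Far₀ w
      far₀-w = ≁v₀⇒Far₀ v₀≁w (≢-sym v₀≢w)
      top-attained : ∃ λ y → y ∈ ∁ σ × toℕ y ≡ mσ n p σ
      top-attained = mσ-attained n p (subst (0 <_) w+p≡m (≤-trans 1≤p (m≤n+m p (toℕ w))))
      y : Fin n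
      y = proj₁ top-attained
      y∈ : y ∈ ∁ σ
      y∈ = proj₁ (proj₂ top-attained)
      y≡w+p : toℕ y ≡ toℕ w + p
      y≡w+p = trans (proj₂ (proj₂ top-attained)) (sym w+p≡m)
      ¬Disc-off : ∀ {a b} → Disc σ a b → a ≢ v₀ → a ≢ w → ⊥
      ¬Disc-off {a} {b} disc a≢v₀ a≢w = Sum.[ a≢v₀ ∘ proj₁ , a≢w ∘ proj₁ ] (unique a b disc)
      x+p≮n : ∀ {x} → x ∈ ∁ σ → x ≢ v₀ → x ≢ w → toℕ x + p ≮ n
      x+p≮n {x} x∈ x≢v₀ x≢w x+p<n with p <? toℕ x | toℕ x + p <? toℕ w
      ... | yes p<x | _ = ¬Disc-off (Disc-sym (v₀∈ , x∈ , ≢-sym x≢v₀ , Far₀⇒≁v₀ (p<x , x+p<n))) x≢v₀ x≢w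
      ... | no _ | yes x+p<w = ¬Disc-off (far⇒Disc x∈ w∈ x+p<w (<-≤-trans (proj₂ far₀-w) (m≤n+m n (toℕ x)))) x≢v₀ x≢w
      ... | no p≮x | no x+p≮w = ¬Disc-off (far⇒Disc x∈ y∈ x+p<y y+p<x+n) x≢v₀ x≢w
        where
        x+p<y : toℕ x + p < toℕ y
        x+p<y = subst (toℕ x + p <_) (sym y≡w+p) (+-monoˡ-< p (≤-<-trans (≮⇒≥ p≮x) (proj₁ far₀-w)))
        w+n≤x+n+p : toℕ w + n ≤ toℕ x + n + p
        w+n≤x+n+p = begin
          toℕ w + n      ≤⟨ +-monoˡ-≤ n (≮⇒≥ x+p≮w) ⟩
          toℕ x + p + n  ≡⟨ +-assoc (toℕ x) p n ⟩
          toℕ x + (p + n) ≡⟨ cong (toℕ x +_) (+-comm p n) ⟩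
          toℕ x + (n + p) ≡⟨ +-assoc (toℕ x) n p ⟨
          toℕ x + n + p  ∎
          where open ≤-Reasoning
        y+p<x+n : toℕ y + p < toℕ x + n
        y+p<x+n = subst (λ i → i + p < toℕ x + n) (sym y≡w+p) (u+n≤v+p⇒u+p+p<v w+n≤x+n+p)

    OnlyDisc⇒Survives : OnlyDisc n p σ → Survives (n ∸ p) σ
    OnlyDisc⇒Survives od = inj₂ (proj₁ od , m+n≤o⇒m≤o∸n (suc (toℕ (proj₁ od))) (proj₂ (Critical.far₀ c)) , c)
      where
      c : Critical (proj₁ od) σ
      c = OnlyDisc⇒Critical od

    Critical⇒mσ-range : ∀ {a} → Critical a σ → n ∸ p ≤ mσ n p σ × mσ n p σ < n
    Critical⇒mσ-range c = subst (n ∸ p ≤_) (sym m≡top) (m≤n+o⇒m∸n≤o n p (subst (n ≤_) (+-comm (toℕ top) p) (top-in-tail c))) ,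
                          subst (_< n) (sym m≡top) (toℕ<n top)
      where
      open Critical c
      m≡top : mσ n p σ ≡ toℕ top
      m≡top = trans (mσ≡ c) (sym toℕ-top)

proposition3p8 : (p n : ℕ) .{{_ : NonZero n}} → 1 ≤ p → 3 * p + 1 ≤ n →
    (σ : Subset n) → Face n p σ →
      (OnlyDisc n p σ → n ∸ p ≤ mσ n p σ × mσ n p σ < n)
      × (C n p (n ∸ p) σ ⇔ OnlyDisc n p σ)
proposition3p8 p n 1≤p 3p+1≤n σ _ =
  (λ od → Critical⇒mσ-range (OnlyDisc⇒Critical od)) ,
  mk⇔ (Survives⇒OnlyDisc ∘ Equivalence.to C⇔) (Equivalence.from C⇔ ∘ OnlyDisc⇒Survives)
  where
  open Stages n p 1≤p 3p+1≤n
  C⇔ : C n p (n ∸ p) σ ⇔ Survives (n ∸ p) σ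
  C⇔ = C⇔Survives (n ∸ p) (m+n≤o⇒m≤o∸n 1 p<n) (≤-reflexive (m∸n+n≡m (<⇒≤ p<n))) σ
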